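{- Let $G=\mathcal G[a_1,\ldots,a_n]$ where $a_1>1$ and $a_n>1$. - If $n$ is even, then either the minimal matching of $G$ uses both dominant edges and the maximal matching uses neither, or vice versa. - If $n$ is odd, then the minimal and maximal matchings each use exactly one dominant edge.
   Context: Snake graphs. A snake graph $G=(G_1,\ldots,G_d)$ is a sequence of unit square tiles in the plane. For each $i<d$, $G_{i+1}$ is glued to $G_i$ either along the north edge $N(G_i)$ or along the east edge $E(G_i)$; $S(G_i),W(G_i)$ are the south and west edges. Sign functions and $\mathcal G[a_1,\ldots,a_n]$. A sign function labels each edge by $\pm$ so that, in every tile, south and east edges agree, north and west edges agree, and north and south edges differ; it is normalized so that $S(G_1)$ is $-$. The sign sequence $(f_1,\ldots,f_{d+1})$ has entries: - $f_1$ is the sign of $S(G_1)$; - $f_{i+1}$ ($1\le i\le d-1$) is the sign of the edge shared by $G_i$ and $G_{i+1}$; - $f_{d+1}=f_d$. $\mathcal G[a_1,\ldots,a_n]$ denotes the unique snake graph whose sign sequence has maximal blocks of equal consecutive signs of lengths $a_1,\ldots,a_n$. Matchings and dominant edges. A boundary edge is an edge lying on only one tile. The minimal matching is the perfect matching consisting only of boundary edges and containing $S(G_1)$; the maximal matching is the other perfect matching consisting only of boundary edges. The dominant edge of $G_1$ is the edge of $\{S(G_1),W(G_1)\}$ both of whose endpoints are incident only to tile $G_1$; the other is non-dominant. Similarly, the dominant edge of $G_d$ is the edge of $\{N(G_d),E(G_d)\}$ with both endpoints incident only to $G_d$. -}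

module Defs where

open import Data.Nat using (ℕ; zero; suc)
open import Data.Bool using (Bool; true; false; if_then_else_; _∧_)
open import Data.Product using (Σ; _×_; _,_; proj₁; proj₂)
open import Data.Sum using (_⊎_)
open import Data.List using (List; []; _∷_; _++_)
open import Data.List.Relation.Unary.Any using (Any)
open import Data.List.Membership.Propositional using (_∈_)
open import Relation.Binary.PropositionalEquality using (_≡_; _≢_)
open import Relation.Nullary using (¬_)

-- Geometry.  A snake graph G = (G₁,…,G_d) is encoded by the list of the
-- d-1 gluing directions; G₁ is placed with lower-left corner at (0,0)
-- (any snake graph is a translate of such a one).

data Dir : Set where
  north east : Dir

Point : Set
Point = ℕ × ℕ

-- a tile is given by its lower-left corner
Tile : Set
Tile = ℕ × ℕ

-- unit edges: hor x y = segment (x,y)-(x+1,y); ver x y = segment (x,y)-(x,y+1)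
data Edge : Set where
  hor ver : ℕ → ℕ → Edge

S W N E : Tile → Edge
S (x , y) = hor x y
N (x , y) = hor x (suc y)
W (x , y) = ver x y
E (x , y) = ver (suc x) y

edgesOf : Tile → List Edge
edgesOf t = S t ∷ E t ∷ N t ∷ W t ∷ []

corners : Tile → List Point
corners (x , y) = (x , y) ∷ (suc x , y) ∷ (x , suc y) ∷ (suc x , suc y) ∷ []

endpoints : Edge → List Point
endpoints (hor x y) = (x , y) ∷ (suc x , y) ∷ []
endpoints (ver x y) = (x , y) ∷ (x , suc y) ∷ []

step : Dir → Tile → Tile
step north (x , y) = (x , suc y)
step east  (x , y) = (suc x , y)

tilesFrom : Tile → List Dir → List Tile
tilesFrom t []       = t ∷ []
tilesFrom t (d ∷ ds) = t ∷ tilesFrom (step d t) ds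

origin : Tile
origin = (0 , 0)

tiles : List Dir → List Tile
tiles ds = tilesFrom origin ds

firstTile : List Dir → Tile
firstTile _ = origin

lastFrom : Tile → List Dir → Tile
lastFrom t []       = t
lastFrom t (d ∷ ds) = lastFrom (step d t) ds

lastTile : List Dir → Tile
lastTile ds = lastFrom origin ds

EdgeOf : List Dir → Edge → Set
EdgeOf ds e = Any (λ t → e ∈ edgesOf t) (tiles ds)

VertexOf : List Dir → Point → Set
VertexOf ds v = Any (λ t → v ∈ corners t) (tiles ds)

Boundary : List Dir → Edge → Set
Boundary ds e = EdgeOf ds e ×
  (∀ {t t'} → t ∈ tiles ds → t' ∈ tiles ds → e ∈ edgesOf t → e ∈ edgesOf t' → t ≡ t')

EdgeSet : Set
EdgeSet = Edge → Bool

IsPerfectMatching : List Dir → EdgeSet → Set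
IsPerfectMatching ds M =
  (∀ e → M e ≡ true → EdgeOf ds e) ×
  (∀ v → VertexOf ds v →
     Σ Edge (λ e → (M e ≡ true) × (v ∈ endpoints e)) ×
     (∀ e e' → M e ≡ true → M e' ≡ true → v ∈ endpoints e → v ∈ endpoints e' → e ≡ e'))

IsBoundaryPerfectMatching : List Dir → EdgeSet → Set
IsBoundaryPerfectMatching ds M =
  IsPerfectMatching ds M × (∀ e → M e ≡ true → Boundary ds e)

IsMinimalMatching : List Dir → EdgeSet → Set
IsMinimalMatching ds M = IsBoundaryPerfectMatching ds M × (M (S (firstTile ds)) ≡ true)

IsMaximalMatching : List Dir → EdgeSet → EdgeSet → Set
IsMaximalMatching ds Mmin M =
  IsBoundaryPerfectMatching ds M × ¬ (∀ e → Mmin e ≡ M e)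

OnlyIncidentTo : List Dir → Tile → Point → Set
OnlyIncidentTo ds t v = ∀ {t'} → t' ∈ tiles ds → v ∈ corners t' → t' ≡ t

BothEndsOnlyAt : List Dir → Tile → Edge → Set
BothEndsOnlyAt ds t e = ∀ v → v ∈ endpoints e → OnlyIncidentTo ds t v

DominantFirst : List Dir → Edge → Set
DominantFirst ds e =
  (e ≡ S (firstTile ds) ⊎ e ≡ W (firstTile ds)) × BothEndsOnlyAt ds (firstTile ds) e

DominantLast : List Dir → Edge → Set
DominantLast ds e =
  (e ≡ N (lastTile ds) ⊎ e ≡ E (lastTile ds)) × BothEndsOnlyAt ds (lastTile ds) e

data Sign : Set where
  plus minus : Sign

_==ˢ_ : Sign → Sign → Bool
plus  ==ˢ plus  = true
minus ==ˢ minus = true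
_     ==ˢ _     = false

IsSignFunction : List Dir → (Edge → Sign) → Set
IsSignFunction ds σ =
  (∀ {t} → t ∈ tiles ds →
     (σ (S t) ≡ σ (E t)) × (σ (N t) ≡ σ (W t)) × (σ (N t) ≢ σ (S t))) ×
  (σ (S (firstTile ds)) ≡ minus)

sharedSigns : (Edge → Sign) → Tile → List Dir → List Sign
sharedSigns σ t []           = []
sharedSigns σ t (north ∷ ds) = σ (N t) ∷ sharedSigns σ (step north t) ds
sharedSigns σ t (east ∷ ds)  = σ (E t) ∷ sharedSigns σ (step east t) ds

lastSign : Sign → List Sign → Sign
lastSign x []       = x
lastSign x (y ∷ ys) = lastSign y ys

signSeq : List Dir → (Edge → Sign) → List Sign
signSeq ds σ =
  let f₁  = σ (S (firstTile ds))
      mid = sharedSigns σ origin ds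
  in  (f₁ ∷ mid) ++ (lastSign f₁ mid ∷ [])

blocksFrom : Sign → ℕ → List Sign → List ℕ
blocksFrom c k []       = k ∷ []
blocksFrom c k (y ∷ ys) =
  if c ==ˢ y then blocksFrom c (suc k) ys else (k ∷ blocksFrom y 1 ys)

blocks : List Sign → List ℕ
blocks []       = []
blocks (x ∷ xs) = blocksFrom x 1 xs

-- Every tile meets the boundary of the snake graph in its south-east and north-west corners, and
-- at each of these exactly two boundary edges meet.  A boundary perfect matching therefore
-- alternates along the lower and along the upper boundary path, so it is determined by whether
-- it contains S(G₁), and its value on the boundary edges of a tile is governed by the parity of
-- the diagonal x + y of the tile; in particular the maximal matching avoids S(G₁).  The blocks
-- may be computed with the checkerboard sign function, whose signs are governed by the same
-- parity, and their number is odd iff the sign sequence ends with the sign it starts with.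
-- Comparing the two parities at the last tile shows that a boundary perfect matching uses the
-- two dominant edges alike iff n is even.  Finally a₁ > 1 forces the snake to start eastwards,
-- which makes W(G₁) the dominant edge of G₁.

module Submission where

open import Defs
open import Data.Nat using (ℕ; zero; suc; _+_; _<_; _≤_; _%_)
open import Data.Nat.Properties using (+-suc; 1+n≢n; 1+n≰n; n≤1+n; ≤-refl; ≤-trans; <⇒≤; <-irrefl; 0≢1+n)
open import Data.Bool using (Bool; true; false; not; _xor_; if_then_else_)
open import Data.Bool.Properties using (not-involutive; not-distribˡ-xor; not-distribʳ-xor; xor-identityʳ)
open import Data.Product using (Σ; _×_; _,_; proj₁; proj₂)
open import Data.Sum using (_⊎_; inj₁; inj₂; [_,_]′)
open import Data.List using (List; []; _∷_; length; head; last; _++_)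
open import Data.List.Relation.Unary.Any using (here; there)
open import Data.List.Membership.Propositional using (_∈_; find; lose)
open import Data.List.Relation.Binary.Subset.Propositional using (_⊆_)
open import Data.Empty using (⊥; ⊥-elim)
open import Data.Maybe using (just)
open import Relation.Binary.PropositionalEquality using (_≡_; _≢_; refl; sym; trans; cong; subst; module ≡-Reasoning)
open import Relation.Nullary using (¬_)

open ≡-Reasoning

odd : ℕ → Bool
odd zero    = false
odd (suc n) = not (odd n)

%2-odd : ∀ n → n % 2 ≡ (if odd n then 1 else 0)
%2-odd zero          = refl
%2-odd (suc zero)    = refl
%2-odd (suc (suc n)) rewrite not-involutive (odd n) = %2-odd n

true≢false : true ≢ false
true≢false ()

≡-if-either-true : ∀ {u v : Bool} → (u ≡ true → u ≡ v) → (v ≡ true → u ≡ v) → u ≡ v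
≡-if-either-true {true}          f g = f refl
≡-if-either-true {false} {true}  f g = g refl
≡-if-either-true {false} {false} f g = refl

diagonal : Tile → ℕ
diagonal (x , y) = x + y

diagonal-step : ∀ d t → diagonal (step d t) ≡ suc (diagonal t)
diagonal-step north (x , y) = +-suc x y
diagonal-step east  (x , y) = refl

step-≢ : ∀ d t → t ≢ step d t
step-≢ d t eq = 1+n≢n (sym (trans (cong diagonal eq) (diagonal-step d t)))

start∈tilesFrom : ∀ t ds → t ∈ tilesFrom t ds
start∈tilesFrom t []      = here refl
start∈tilesFrom t (_ ∷ _) = here refl

lastFrom∈tilesFrom : ∀ t ds → lastFrom t ds ∈ tilesFrom t ds
lastFrom∈tilesFrom t []       = here refl
lastFrom∈tilesFrom t (d ∷ ds) = there (lastFrom∈tilesFrom (step d t) ds)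

diagonal-≤-tilesFrom : ∀ {t t'} ds → t' ∈ tilesFrom t ds → diagonal t ≤ diagonal t'
diagonal-≤-tilesFrom []       (here refl) = ≤-refl
diagonal-≤-tilesFrom (d ∷ ds) (here refl) = ≤-refl
diagonal-≤-tilesFrom {t} {t'} (d ∷ ds) (there t'∈) =
  ≤-trans (n≤1+n (diagonal t)) (subst (_≤ diagonal t') (diagonal-step d t) (diagonal-≤-tilesFrom ds t'∈))

diagonal-<-tilesFrom-step : ∀ {t t'} d ds → t' ∈ tilesFrom (step d t) ds → diagonal t < diagonal t'
diagonal-<-tilesFrom-step {t} {t'} d ds t'∈ =
  subst (_≤ diagonal t') (diagonal-step d t) (diagonal-≤-tilesFrom ds t'∈)

diagonal-≤-lastFrom : ∀ {t t'} ds → t' ∈ tilesFrom t ds → diagonal t' ≤ diagonal (lastFrom t ds)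
diagonal-≤-lastFrom []       (here refl) = ≤-refl
diagonal-≤-lastFrom {t} (d ∷ ds) (here refl) =
  <⇒≤ (diagonal-<-tilesFrom-step d ds (lastFrom∈tilesFrom (step d t) ds))
diagonal-≤-lastFrom (d ∷ ds) (there t'∈) = diagonal-≤-lastFrom ds t'∈

tilesFrom-diagonal-injective : ∀ {t t₁ t₂} ds → t₁ ∈ tilesFrom t ds → t₂ ∈ tilesFrom t ds →
  diagonal t₁ ≡ diagonal t₂ → t₁ ≡ t₂
tilesFrom-diagonal-injective []       (here refl) (here refl) _ = refl
tilesFrom-diagonal-injective (d ∷ ds) (here refl) (here refl) _ = refl
tilesFrom-diagonal-injective (d ∷ ds) (here refl) (there t₂∈) eq =
  ⊥-elim (<-irrefl eq (diagonal-<-tilesFrom-step d ds t₂∈))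
tilesFrom-diagonal-injective (d ∷ ds) (there t₁∈) (here refl) eq =
  ⊥-elim (<-irrefl (sym eq) (diagonal-<-tilesFrom-step d ds t₁∈))
tilesFrom-diagonal-injective (d ∷ ds) (there t₁∈) (there t₂∈) eq =
  tilesFrom-diagonal-injective ds t₁∈ t₂∈ eq

penultimate : Tile → Dir → List Dir → Tile
penultimate t d []        = t
penultimate t d (d' ∷ ds) = penultimate (step d t) d' ds

lastDir : Dir → List Dir → Dir
lastDir d []        = d
lastDir d (d' ∷ ds) = lastDir d' ds

penultimate∈tilesFrom : ∀ t d ds → penultimate t d ds ∈ tilesFrom t (d ∷ ds)
penultimate∈tilesFrom t d []        = here refl
penultimate∈tilesFrom t d (d' ∷ ds) = there (penultimate∈tilesFrom (step d t) d' ds)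

lastFrom-penultimate : ∀ t d ds → lastFrom t (d ∷ ds) ≡ step (lastDir d ds) (penultimate t d ds)
lastFrom-penultimate t d []        = refl
lastFrom-penultimate t d (d' ∷ ds) = lastFrom-penultimate (step d t) d' ds

sharedEdge : Dir → Tile → Edge
sharedEdge north = N
sharedEdge east  = E

lastSign-sharedSigns : ∀ σ c t d ds →
  lastSign c (sharedSigns σ t (d ∷ ds)) ≡ σ (sharedEdge (lastDir d ds) (penultimate t d ds))
lastSign-sharedSigns σ c t north []        = refl
lastSign-sharedSigns σ c t east  []        = refl
lastSign-sharedSigns σ c t north (d' ∷ ds) = lastSign-sharedSigns σ _ (step north t) d' ds
lastSign-sharedSigns σ c t east  (d' ∷ ds) = lastSign-sharedSigns σ _ (step east t) d' ds

data Side : Edge → Tile → Set where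
  bottom : ∀ {x y} → Side (hor x y) (x , y)
  top    : ∀ {x y} → Side (hor x (suc y)) (x , y)
  left   : ∀ {x y} → Side (ver x y) (x , y)
  right  : ∀ {x y} → Side (ver (suc x) y) (x , y)

side : ∀ {e t} → e ∈ edgesOf t → Side e t
side {t = _ , _} (here refl)                         = bottom
side {t = _ , _} (there (here refl))                 = right
side {t = _ , _} (there (there (here refl)))         = top
side {t = _ , _} (there (there (there (here refl)))) = left
side {t = _ , _} (there (there (there (there ()))))

side⁻¹ : ∀ {e t} → Side e t → e ∈ edgesOf t
side⁻¹ bottom = here refl
side⁻¹ right  = there (here refl)
side⁻¹ top    = there (there (here refl))
side⁻¹ left   = there (there (there (here refl)))

source target : Edge → Point
source (hor x y) = (x , y)
source (ver x y) = (x , y)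
target (hor x y) = (suc x , y)
target (ver x y) = (x , suc y)

source≢target : ∀ e → source e ≢ target e
source≢target (hor x y) eq = 1+n≢n (sym (cong proj₁ eq))
source≢target (ver x y) eq = 1+n≢n (sym (cong proj₂ eq))

source∈endpoints : ∀ e → source e ∈ endpoints e
source∈endpoints (hor x y) = here refl
source∈endpoints (ver x y) = here refl

target∈endpoints : ∀ e → target e ∈ endpoints e
target∈endpoints (hor x y) = there (here refl)
target∈endpoints (ver x y) = there (here refl)

edges-at-origin : ∀ {e} → (0 , 0) ∈ endpoints e → e ≡ S origin ⊎ e ≡ W origin
edges-at-origin {hor _ _} (here refl)         = inj₁ refl
edges-at-origin {ver _ _} (here refl)         = inj₂ refl
edges-at-origin {hor _ _} (there (here ()))
edges-at-origin {ver _ _} (there (here ()))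
edges-at-origin {hor _ _} (there (there ()))
edges-at-origin {ver _ _} (there (there ()))

se nw : Tile → Point
se (x , y) = (suc x , y)
nw (x , y) = (x , suc y)

se∈corners : ∀ t → se t ∈ corners t
se∈corners (x , y) = there (here refl)

nw∈corners : ∀ t → nw t ∈ corners t
nw∈corners (x , y) = there (there (here refl))

-- Any sign function determines the blocks; this one is explicit in the coordinates.
checkerboard : Edge → Sign
checkerboard (hor x y) = if odd (x + y) then plus else minus
checkerboard (ver x y) = if odd (x + y) then minus else plus

checkerboard-tile : ∀ t →
  checkerboard (S t) ≡ checkerboard (E t) × checkerboard (N t) ≡ checkerboard (W t) ×
  checkerboard (N t) ≢ checkerboard (S t)
checkerboard-tile (x , y) rewrite +-suc x y with odd (x + y)
... | true  = refl , refl , λ ()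
... | false = refl , refl , λ ()

checkerboard-isSignFunction : ∀ ds → IsSignFunction ds checkerboard
checkerboard-isSignFunction ds = (λ {t} _ → checkerboard-tile t) , refl

minus-checkerboard-hor : ∀ x y → (minus ==ˢ checkerboard (hor x y)) ≡ not (odd (x + y))
minus-checkerboard-hor x y with odd (x + y)
... | true  = refl
... | false = refl

minus-checkerboard-ver : ∀ x y → (minus ==ˢ checkerboard (ver x y)) ≡ odd (x + y)
minus-checkerboard-ver x y with odd (x + y)
... | true  = refl
... | false = refl

==ˢ-refl : ∀ c → (c ==ˢ c) ≡ true
==ˢ-refl plus  = refl
==ˢ-refl minus = refl

opposite : Sign → Sign
opposite plus  = minus
opposite minus = plus

not-opposite-==ˢ : ∀ c z → not (opposite c ==ˢ z) ≡ (c ==ˢ z)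
not-opposite-==ˢ plus  plus  = refl
not-opposite-==ˢ plus  minus = refl
not-opposite-==ˢ minus plus  = refl
not-opposite-==ˢ minus minus = refl

odd-length-blocksFrom : ∀ c k ys → odd (length (blocksFrom c k ys)) ≡ (c ==ˢ lastSign c ys)
odd-length-blocksFrom c     k []           = sym (==ˢ-refl c)
odd-length-blocksFrom plus  k (plus  ∷ ys) = odd-length-blocksFrom plus (suc k) ys
odd-length-blocksFrom minus k (minus ∷ ys) = odd-length-blocksFrom minus (suc k) ys
odd-length-blocksFrom plus  k (minus ∷ ys) =
  trans (cong not (odd-length-blocksFrom minus 1 ys)) (not-opposite-==ˢ plus (lastSign minus ys))
odd-length-blocksFrom minus k (plus  ∷ ys) =
  trans (cong not (odd-length-blocksFrom plus 1 ys)) (not-opposite-==ˢ minus (lastSign plus ys))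

lastSign-∷ʳ : ∀ c xs z → lastSign c (xs ++ z ∷ []) ≡ z
lastSign-∷ʳ c []       z = refl
lastSign-∷ʳ c (x ∷ xs) z = lastSign-∷ʳ x xs z

odd-length-blocks : ∀ ds σ →
  odd (length (blocks (signSeq ds σ))) ≡ (σ (S origin) ==ˢ lastSign (σ (S origin)) (sharedSigns σ origin ds))
odd-length-blocks ds σ =
  trans (odd-length-blocksFrom f₁ 1 (mid ++ lastSign f₁ mid ∷ [])) (cong (f₁ ==ˢ_) (lastSign-∷ʳ f₁ mid _))
  where
    f₁  = σ (S origin)
    mid = sharedSigns σ origin ds

odd-length-blocks-checkerboard : ∀ d rs →
  odd (length (blocks (signSeq (d ∷ rs) checkerboard)))
    ≡ (minus ==ˢ checkerboard (sharedEdge (lastDir d rs) (penultimate origin d rs)))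
odd-length-blocks-checkerboard d rs =
  trans (odd-length-blocks (d ∷ rs) checkerboard)
        (cong (minus ==ˢ_) (lastSign-sharedSigns checkerboard minus origin d rs))

first-block-north : ∀ rs → head (blocks (signSeq (north ∷ rs) checkerboard)) ≡ just 1
first-block-north rs = refl

module Snake (ds : List Dir) where

  private
    T : List Tile
    T = tiles ds

  ¬east-and-north : ∀ {x y} → (suc x , y) ∈ T → (x , suc y) ∈ T → ⊥
  ¬east-and-north {x} {y} m m' =
    1+n≢n (cong proj₁ (tilesFrom-diagonal-injective ds m m' (sym (+-suc x y))))

  beyond-last : ∀ {t} → t ≡ lastTile ds → ∀ d → step d t ∈ T → ⊥
  beyond-last refl d m =
    1+n≰n (subst (_≤ diagonal (lastTile ds)) (diagonal-step d (lastTile ds)) (diagonal-≤-lastFrom ds m))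

  sharedEdge-interior : ∀ d {t} → t ∈ T → step d t ∈ T → ¬ Boundary ds (sharedEdge d t)
  sharedEdge-interior north {x , y} m m' (_ , one-tile) =
    step-≢ north (x , y) (one-tile m m' (side⁻¹ top) (side⁻¹ bottom))
  sharedEdge-interior east  {x , y} m m' (_ , one-tile) =
    step-≢ east (x , y) (one-tile m m' (side⁻¹ right) (side⁻¹ left))

  ¬EdgeOf : ∀ {e} → (∀ {t} → t ∈ T → Side e t → ⊥) → ¬ EdgeOf ds e
  ¬EdgeOf no e∈G with find e∈G
  ... | _ , m , e∈t = no m (side e∈t)

  -- Edges are oriented north/east.  Through the south-east corner of a tile pass the boundary
  -- edges lowerIn (ending there) and lowerOut (starting there), through its north-west corner
  -- upperIn and upperOut; which edges these are depends on how the snake enters and leaves.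
  data Entry : Tile → Set where
    first     : Entry origin
    fromWest  : ∀ {x y} → (x , y) ∈ T → Entry (suc x , y)
    fromSouth : ∀ {x y} → (x , y) ∈ T → Entry (x , suc y)

  data Exit (t : Tile) : Set where
    final : t ≡ lastTile ds → Exit t
    next : ∀ d → step d t ∈ T → Exit t

  enter : ∀ d {t} → t ∈ T → Entry (step d t)
  enter north {_ , _} m = fromSouth m
  enter east  {_ , _} m = fromWest m

  lowerIn upperIn : ∀ {t} → Entry t → Edge
  lowerIn first                 = S origin
  lowerIn (fromWest {x} {y} _)  = S (suc x , y)
  lowerIn (fromSouth {x} {y} _) = E (x , y)
  upperIn first                 = W origin
  upperIn (fromWest {x} {y} _)  = N (x , y)
  upperIn (fromSouth {x} {y} _) = W (x , suc y)

  lowerOut upperOut : ∀ {t} → Exit t → Edge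
  lowerOut {t} (final _)       = E t
  lowerOut {t} (next north _)  = E t
  lowerOut {t} (next east _)   = S (step east t)
  upperOut {t} (final _)       = N t
  upperOut {t} (next north _)  = W (step north t)
  upperOut {t} (next east _)   = N t

  target-lowerIn : ∀ {t} (en : Entry t) → target (lowerIn en) ≡ se t
  target-lowerIn first         = refl
  target-lowerIn (fromWest _)  = refl
  target-lowerIn (fromSouth _) = refl

  target-upperIn : ∀ {t} (en : Entry t) → target (upperIn en) ≡ nw t
  target-upperIn first         = refl
  target-upperIn (fromWest _)  = refl
  target-upperIn (fromSouth _) = refl

  source-lowerOut : ∀ {t} (ex : Exit t) → source (lowerOut ex) ≡ se t
  source-lowerOut {_ , _} (final _)       = refl
  source-lowerOut {_ , _} (next north _) = refl
  source-lowerOut {_ , _} (next east _)  = refl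

  source-upperOut : ∀ {t} (ex : Exit t) → source (upperOut ex) ≡ nw t
  source-upperOut {_ , _} (final _)       = refl
  source-upperOut {_ , _} (next north _) = refl
  source-upperOut {_ , _} (next east _)  = refl

  boundary-at-se : ∀ {t} → t ∈ T → (en : Entry t) (ex : Exit t) →
    ∀ {e} → Boundary ds e → se t ∈ endpoints e → e ≡ lowerIn en ⊎ e ≡ lowerOut ex
  boundary-at-se {_ , _} m en (next east _)   {hor _ _} bd (here refl) = inj₂ refl
  boundary-at-se {_ , _} m en (next north m₂) {hor _ _} bd (here refl) =
    ⊥-elim (¬EdgeOf (λ { m' bottom → ¬east-and-north m' m₂ ; m' top → ¬east-and-north m' m }) (proj₁ bd))
  boundary-at-se {_ , _} m en (final eq)      {hor _ _} bd (here refl) =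
    ⊥-elim (¬EdgeOf (λ { m' bottom → beyond-last eq east m' ; m' top → ¬east-and-north m' m }) (proj₁ bd))
  boundary-at-se {_ , _} m first          ex  {hor _ _} bd (there (here refl)) = inj₁ refl
  boundary-at-se {_ , _} m (fromWest _)   ex  {hor _ _} bd (there (here refl)) = inj₁ refl
  boundary-at-se {_ , _} m (fromSouth m₀) ex  {hor _ _} bd (there (here refl)) =
    ⊥-elim (sharedEdge-interior north m₀ m bd)
  boundary-at-se {_ , _} m en (final _)       {ver _ _} bd (here refl) = inj₂ refl
  boundary-at-se {_ , _} m en (next north _)  {ver _ _} bd (here refl) = inj₂ refl
  boundary-at-se {_ , _} m en (next east m₂)  {ver _ _} bd (here refl) =
    ⊥-elim (sharedEdge-interior east m m₂ bd)
  boundary-at-se {_ , _} m (fromSouth _)  ex  {ver _ _} bd (there (here refl)) = inj₁ refl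
  boundary-at-se {_ , _} m (fromWest m₀)  ex  {ver _ _} bd (there (here refl)) =
    ⊥-elim (¬EdgeOf (λ { m' left → ¬east-and-north m' m ; m' right → ¬east-and-north m' m₀ }) (proj₁ bd))
  boundary-at-se {_ , _} m en ex {hor _ _} bd (there (there ()))
  boundary-at-se {_ , _} m en ex {ver _ _} bd (there (there ()))

  boundary-at-nw : ∀ {t} → t ∈ T → (en : Entry t) (ex : Exit t) →
    ∀ {e} → Boundary ds e → nw t ∈ endpoints e → e ≡ upperIn en ⊎ e ≡ upperOut ex
  boundary-at-nw {_ , _} m en (final _)       {hor _ _} bd (here refl) = inj₂ refl
  boundary-at-nw {_ , _} m en (next east _)   {hor _ _} bd (here refl) = inj₂ refl
  boundary-at-nw {_ , _} m en (next north m₂) {hor _ _} bd (here refl) =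
    ⊥-elim (sharedEdge-interior north m m₂ bd)
  boundary-at-nw {_ , _} m (fromWest _)   ex  {hor _ _} bd (there (here refl)) = inj₁ refl
  boundary-at-nw {_ , _} m (fromSouth m₀) ex  {hor _ _} bd (there (here refl)) =
    ⊥-elim (¬EdgeOf (λ { m' bottom → ¬east-and-north m m' ; m' top → ¬east-and-north m₀ m' }) (proj₁ bd))
  boundary-at-nw {_ , _} m en (next north _)  {ver _ _} bd (here refl) = inj₂ refl
  boundary-at-nw {_ , _} m en (next east m₂)  {ver _ _} bd (here refl) =
    ⊥-elim (¬EdgeOf (λ { m' left → ¬east-and-north m₂ m' ; m' right → ¬east-and-north m m' }) (proj₁ bd))
  boundary-at-nw {_ , _} m en (final eq)      {ver _ _} bd (here refl) =
    ⊥-elim (¬EdgeOf (λ { m' left → beyond-last eq north m' ; m' right → ¬east-and-north m m' }) (proj₁ bd))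
  boundary-at-nw {_ , _} m first          ex  {ver _ _} bd (there (here refl)) = inj₁ refl
  boundary-at-nw {_ , _} m (fromSouth _)  ex  {ver _ _} bd (there (here refl)) = inj₁ refl
  boundary-at-nw {_ , _} m (fromWest m₀)  ex  {ver _ _} bd (there (here refl)) =
    ⊥-elim (sharedEdge-interior east m₀ m bd)
  boundary-at-nw {_ , _} m en ex {hor _ _} bd (there (there ()))
  boundary-at-nw {_ , _} m en ex {ver _ _} bd (there (there ()))

  module Walk (P : ∀ {t} → Entry t → Set) (P-first : P first)
              (P-enter : ∀ {t} (m : t ∈ T) {en : Entry t} d → step d t ∈ T → P en → P (enter d m)) where

    walkFrom : ∀ t rs → tilesFrom t rs ⊆ T → lastFrom t rs ≡ lastTile ds → Σ (Entry t) P →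
               ∀ {t'} → t' ∈ tilesFrom t rs → Σ (Entry t') P × Exit t'
    walkFrom t []       _   t≡L entry (here refl) = entry , final t≡L
    walkFrom t (d ∷ rs) sub _   entry (here refl) = entry , next d (sub (there (start∈tilesFrom (step d t) rs)))
    walkFrom t (d ∷ rs) sub last≡ (en , p) (there t'∈) =
      walkFrom (step d t) rs (λ u∈ → sub (there u∈)) last≡ (enter d m , P-enter m d m' p) t'∈
      where
        m  = sub (here refl)
        m' = sub (there (start∈tilesFrom (step d t) rs))

    walk : ∀ {t} → t ∈ T → Σ (Entry t) P × Exit t
    walk = walkFrom origin ds (λ t∈ → t∈) refl (first , P-first)

  frame : ∀ {t} → Entry t → Exit t → List Edge
  frame en ex = lowerIn en ∷ lowerOut ex ∷ upperIn en ∷ upperOut ex ∷ []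

  boundary∈frame : ∀ {t e} → t ∈ T → (en : Entry t) (ex : Exit t) →
    Boundary ds e → e ∈ edgesOf t → e ∈ frame en ex
  boundary∈frame {_ , _} m en ex bd e∈t with side e∈t
  ... | bottom = [ here , (λ eq → there (here eq)) ]′ (boundary-at-se m en ex bd (there (here refl)))
  ... | right  = [ here , (λ eq → there (here eq)) ]′ (boundary-at-se m en ex bd (here refl))
  ... | top    = [ (λ eq → there (there (here eq))) , (λ eq → there (there (there (here eq)))) ]′
                   (boundary-at-nw m en ex bd (here refl))
  ... | left   = [ (λ eq → there (there (here eq))) , (λ eq → there (there (there (here eq)))) ]′
                   (boundary-at-nw m en ex bd (there (here refl)))

  module BoundaryMatching {M : EdgeSet} (isM : IsBoundaryPerfectMatching ds M) where

    complementary : ∀ {p a c} → VertexOf ds p → a ≢ c → p ∈ endpoints a → p ∈ endpoints c →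
      (∀ {e} → Boundary ds e → p ∈ endpoints e → e ≡ a ⊎ e ≡ c) → M c ≡ not (M a)
    complementary {p} {a} {c} p∈G a≢c p∈a p∈c only-a-c with M a in Ma | M c in Mc
    ... | true  | true  = ⊥-elim (a≢c (proj₂ (proj₂ (proj₁ isM) p p∈G) a c Ma Mc p∈a p∈c))
    ... | true  | false = refl
    ... | false | true  = refl
    ... | false | false with proj₁ (proj₂ (proj₁ isM) p p∈G)
    ... | e , Me , p∈e with only-a-c (proj₂ isM e Me) p∈e
    ... | inj₁ refl = ⊥-elim (true≢false (trans (sym Me) Ma))
    ... | inj₂ refl = ⊥-elim (true≢false (trans (sym Me) Mc))

    flip-at-origin : M (W origin) ≡ not (M (S origin))
    flip-at-origin = complementary (lose (start∈tilesFrom origin ds) (here refl)) (λ ())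
      (here refl) (here refl) (λ _ → edges-at-origin)

    flip-through : ∀ {t p a c} → t ∈ T → p ∈ corners t → target a ≡ p → source c ≡ p →
      (∀ {e} → Boundary ds e → p ∈ endpoints e → e ≡ a ⊎ e ≡ c) → M c ≡ not (M a)
    flip-through {a = a} {c} m p∈t a→p p→c = complementary (lose m p∈t)
      (λ a≡c → source≢target a (trans (cong source a≡c) (trans p→c (sym a→p))))
      (subst (_∈ endpoints a) a→p (target∈endpoints a))
      (subst (_∈ endpoints c) p→c (source∈endpoints c))

    flip-at-se : ∀ {t} → t ∈ T → (en : Entry t) (ex : Exit t) → M (lowerOut ex) ≡ not (M (lowerIn en))
    flip-at-se {t} m en ex =
      flip-through m (se∈corners t) (target-lowerIn en) (source-lowerOut ex) (boundary-at-se m en ex)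

    flip-at-nw : ∀ {t} → t ∈ T → (en : Entry t) (ex : Exit t) → M (upperOut ex) ≡ not (M (upperIn en))
    flip-at-nw {t} m en ex =
      flip-through m (nw∈corners t) (target-upperIn en) (source-upperOut ex) (boundary-at-nw m en ex)

    flip-on-enter : ∀ {t} (m : t ∈ T) (en : Entry t) d → step d t ∈ T →
      M (lowerIn (enter d m)) ≡ not (M (lowerIn en)) × M (upperIn (enter d m)) ≡ not (M (upperIn en))
    flip-on-enter {_ , _} m en north m' = flip-at-se m en (next north m') , flip-at-nw m en (next north m')
    flip-on-enter {_ , _} m en east  m' = flip-at-se m en (next east m') , flip-at-nw m en (next east m')

    Alternating : ∀ {t} → Entry t → Set
    Alternating {t} en = M (lowerIn en) ≡ M (S origin) xor odd (diagonal t) × M (upperIn en) ≡ not (M (lowerIn en))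

    alternating-enter : ∀ {t} (m : t ∈ T) {en : Entry t} d → step d t ∈ T →
      Alternating en → Alternating (enter d m)
    alternating-enter {t} m {en} d m' (lower , upper) = lower′ , upper′
      where
        b = M (S origin)
        flips = flip-on-enter m en d m'
        lower′ = begin
          M (lowerIn (enter d m))         ≡⟨ proj₁ flips ⟩
          not (M (lowerIn en))            ≡⟨ cong not lower ⟩
          not (b xor odd (diagonal t))    ≡⟨ not-distribʳ-xor b _ ⟩
          b xor odd (suc (diagonal t))    ≡⟨ cong (λ n → b xor odd n) (sym (diagonal-step d t)) ⟩
          b xor odd (diagonal (step d t)) ∎
        upper′ = begin
          M (upperIn (enter d m))         ≡⟨ proj₂ flips ⟩
          not (M (upperIn en))            ≡⟨ cong not upper ⟩
          not (not (M (lowerIn en)))      ≡⟨ cong not (sym (proj₁ flips)) ⟩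
          not (M (lowerIn (enter d m)))   ∎

    module Alternation = Walk Alternating (sym (xor-identityʳ _) , flip-at-origin) alternating-enter

    last-values : ∀ {L} → L ≡ lastTile ds →
      M (E L) ≡ not (M (S origin) xor odd (diagonal L)) × M (N L) ≡ M (S origin) xor odd (diagonal L)
    last-values refl with Alternation.walk (lastFrom∈tilesFrom origin ds)
    ... | (en , lower , upper) , _ =
      trans (flip-at-se L∈T en (final refl)) (cong not lower) ,
      trans (flip-at-nw L∈T en (final refl)) (trans (cong not upper) (trans (not-involutive _) lower))
      where L∈T = lastFrom∈tilesFrom origin ds

    -- Both the matching and the checkerboard sign of the last shared edge are read off the parity
    -- of the diagonal of the last tile.
    dominantLast-value : ∀ d p {L} → L ≡ lastTile ds → L ≡ step d p →
      M (sharedEdge d L) ≡ not (M (S origin) xor (minus ==ˢ checkerboard (sharedEdge d p)))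
    dominantLast-value north (x , y) L≡ refl = begin
      M (N (x , suc y))                 ≡⟨ proj₂ (last-values L≡) ⟩
      b xor o                           ≡⟨ sym (not-involutive _) ⟩
      not (not (b xor o))               ≡⟨ cong not (not-distribʳ-xor b o) ⟩
      not (b xor not o)                 ≡⟨ cong (λ s → not (b xor s)) (sym (minus-checkerboard-hor x (suc y))) ⟩
      not (b xor (minus ==ˢ checkerboard (hor x (suc y)))) ∎
      where
        b = M (S origin)
        o = odd (x + suc y)
    dominantLast-value east (x , y) L≡ refl = begin
      M (E (suc x , y))                 ≡⟨ proj₁ (last-values L≡) ⟩
      not (b xor odd (suc x + y))       ≡⟨ cong (λ s → not (b xor s)) (sym (minus-checkerboard-ver (suc x) y)) ⟩
      not (b xor (minus ==ˢ checkerboard (ver (suc x) y))) ∎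
      where b = M (S origin)

  boundaryMatching-unique : ∀ {M M'} → IsBoundaryPerfectMatching ds M → IsBoundaryPerfectMatching ds M' →
    M (S origin) ≡ M' (S origin) → ∀ e → M e ≡ M' e
  boundaryMatching-unique {M} {M'} isM isM' same e =
    ≡-if-either-true (λ Me → agree-on-boundary (proj₂ isM e Me)) (λ M'e → agree-on-boundary (proj₂ isM' e M'e))
    where
      module B  = BoundaryMatching isM
      module B' = BoundaryMatching isM'

      both-flip : ∀ {a a'} → M a' ≡ not (M a) → M' a' ≡ not (M' a) → M a ≡ M' a → M a' ≡ M' a'
      both-flip flip flip' eq = trans flip (trans (cong not eq) (sym flip'))

      Agree : ∀ {t} → Entry t → Set
      Agree en = M (lowerIn en) ≡ M' (lowerIn en) × M (upperIn en) ≡ M' (upperIn en)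

      agree-enter : ∀ {t} (m : t ∈ T) {en : Entry t} d → step d t ∈ T → Agree en → Agree (enter d m)
      agree-enter m {en} d m' (lower , upper) =
        both-flip (proj₁ (B.flip-on-enter m en d m')) (proj₁ (B'.flip-on-enter m en d m')) lower ,
        both-flip (proj₂ (B.flip-on-enter m en d m')) (proj₂ (B'.flip-on-enter m en d m')) upper

      module Agreement = Walk Agree (same , both-flip B.flip-at-origin B'.flip-at-origin same) agree-enter

      agree-on-frame : ∀ {t e} → t ∈ T → (en : Entry t) (ex : Exit t) →
        Agree en → e ∈ frame en ex → M e ≡ M' e
      agree-on-frame m en ex (lower , upper) (here refl) = lower
      agree-on-frame m en ex (lower , upper) (there (here refl)) =
        both-flip (B.flip-at-se m en ex) (B'.flip-at-se m en ex) lower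
      agree-on-frame m en ex (lower , upper) (there (there (here refl))) = upper
      agree-on-frame m en ex (lower , upper) (there (there (there (here refl)))) =
        both-flip (B.flip-at-nw m en ex) (B'.flip-at-nw m en ex) upper

      agree-on-boundary : ∀ {e} → Boundary ds e → M e ≡ M' e
      agree-on-boundary bd with find (proj₁ bd)
      ... | _ , m , e∈t with Agreement.walk m
      ... | (en , agree) , ex = agree-on-frame m en ex agree (boundary∈frame m en ex bd e∈t)

  dominantFirst-W : ∀ {e} → step east origin ∈ T → DominantFirst ds e → e ≡ W origin
  dominantFirst-W _ (inj₂ eq , _)      = eq
  dominantFirst-W m (inj₁ refl , only) =
    ⊥-elim (step-≢ east origin (sym (only (1 , 0) (there (here refl)) m (here refl))))

  dominantLast-shared : ∀ d {p L e} → p ∈ T → L ≡ step d p →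
    (e ≡ N L ⊎ e ≡ E L) → BothEndsOnlyAt ds L e →
    e ≡ sharedEdge d L
  dominantLast-shared north         _ refl (inj₁ eq)   _    = eq
  dominantLast-shared east          _ refl (inj₂ eq)   _    = eq
  dominantLast-shared north {x , y} m refl (inj₂ refl) only =
    ⊥-elim (step-≢ north (x , y) (only (suc x , suc y) (here refl) m (there (there (there (here refl))))))
  dominantLast-shared east  {x , y} m refl (inj₁ refl) only =
    ⊥-elim (step-≢ east (x , y) (only (suc x , suc y) (here refl) m (there (there (there (here refl))))))

dominantFirst-value : ∀ rs {M e} → IsBoundaryPerfectMatching (east ∷ rs) M → DominantFirst (east ∷ rs) e →
  M e ≡ not (M (S origin))
dominantFirst-value rs {M} isM dom =
  trans (cong M (dominantFirst-W (there (start∈tilesFrom (1 , 0) rs)) dom)) flip-at-origin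
  where
    open Snake (east ∷ rs)
    open BoundaryMatching isM

maximal-avoids-S : ∀ ds {Mmin Mmax} → IsMinimalMatching ds Mmin → IsMaximalMatching ds Mmin Mmax →
  Mmax (S origin) ≡ false
maximal-avoids-S ds {Mmin} {Mmax} (isMin , Mmin-S) (isMax , Mmax≢Mmin) with Mmax (S origin) in eq
... | false = refl
... | true  = ⊥-elim (Mmax≢Mmin (Snake.boundaryMatching-unique ds isMin isMax (trans Mmin-S (sym eq))))

dominant-parity : ∀ rs {M e₁ e₂} → IsBoundaryPerfectMatching (east ∷ rs) M →
  DominantFirst (east ∷ rs) e₁ → DominantLast (east ∷ rs) e₂ →
  M e₂ ≡ M e₁ xor odd (length (blocks (signSeq (east ∷ rs) checkerboard)))
dominant-parity rs {M} {e₁} {e₂} isM dom₁ (at-last , only) = begin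
  M e₂                                  ≡⟨ cong M (dominantLast-shared d p∈G L≡ at-last only) ⟩
  M (sharedEdge d (lastTile ds))        ≡⟨ dominantLast-value d p refl L≡ ⟩
  not (M (S origin) xor s)              ≡⟨ not-distribˡ-xor (M (S origin)) s ⟩
  not (M (S origin)) xor s              ≡⟨ cong (_xor s) (sym (dominantFirst-value rs isM dom₁)) ⟩
  M e₁ xor s                            ≡⟨ cong (M e₁ xor_) (sym (odd-length-blocks-checkerboard east rs)) ⟩
  M e₁ xor odd (length (blocks (signSeq ds checkerboard))) ∎
  where
    ds = east ∷ rs
    open Snake ds
    open BoundaryMatching isM
    d   = lastDir east rs
    p   = penultimate origin east rs
    p∈G = penultimate∈tilesFrom origin east rs
    L≡  = lastFrom-penultimate origin east rs
    s   = minus ==ˢ checkerboard (sharedEdge d p)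

dominant-edges-by-parity : ∀ n {u₁ u₂ w₁ w₂} →
  u₁ ≡ false → w₁ ≡ true → u₂ ≡ u₁ xor odd n → w₂ ≡ w₁ xor odd n →
  (n % 2 ≡ 0 →
    ((u₁ ≡ true × u₂ ≡ true) × (w₁ ≡ false × w₂ ≡ false)) ⊎
    ((w₁ ≡ true × w₂ ≡ true) × (u₁ ≡ false × u₂ ≡ false))) ×
  (n % 2 ≡ 1 → (u₁ xor u₂ ≡ true) × (w₁ xor w₂ ≡ true))
dominant-edges-by-parity n refl refl refl refl with odd n | %2-odd n
... | false | n%2≡0 =
  (λ _ → inj₂ ((refl , refl) , (refl , refl))) , λ n%2≡1 → ⊥-elim (0≢1+n (trans (sym n%2≡0) n%2≡1))
... | true  | n%2≡1 =
  (λ n%2≡0 → ⊥-elim (0≢1+n (trans (sym n%2≡0) n%2≡1))) , λ _ → refl , refl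

lemma5p2 : (ds : List Dir) → 1 ≤ length ds →
    (as : List ℕ) →
    ((σ : Edge → Sign) → IsSignFunction ds σ → blocks (signSeq ds σ) ≡ as) →
    (∀ a → head as ≡ just a → 1 < a) →
    (∀ a → last as ≡ just a → 1 < a) →
    (Mmin Mmax : EdgeSet) → IsMinimalMatching ds Mmin → IsMaximalMatching ds Mmin Mmax →
    (e₁ e₂ : Edge) → DominantFirst ds e₁ → DominantLast ds e₂ →
    (length as % 2 ≡ 0 →
      ((Mmin e₁ ≡ true × Mmin e₂ ≡ true) × (Mmax e₁ ≡ false × Mmax e₂ ≡ false)) ⊎
      ((Mmax e₁ ≡ true × Mmax e₂ ≡ true) × (Mmin e₁ ≡ false × Mmin e₂ ≡ false))) ×
    (length as % 2 ≡ 1 →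
      (Mmin e₁ xor Mmin e₂ ≡ true) × (Mmax e₁ xor Mmax e₂ ≡ true))
lemma5p2 [] () _ _ _ _ _ _ _ _ _ _ _ _
lemma5p2 (north ∷ rs) _ as blocks≡as first>1 _ _ _ _ _ _ _ _ _ =
  ⊥-elim (<-irrefl refl (first>1 1 (subst (λ bs → head bs ≡ just 1) blocks≡ (first-block-north rs))))
  where blocks≡ = blocks≡as checkerboard (checkerboard-isSignFunction (north ∷ rs))
lemma5p2 (east ∷ rs) _ as blocks≡as _ _ Mmin Mmax isMin isMax e₁ e₂ dom₁ dom₂
  with blocks≡as checkerboard (checkerboard-isSignFunction (east ∷ rs))
... | refl = dominant-edges-by-parity (length as)
               (trans (dominantFirst-value rs (proj₁ isMin) dom₁) (cong not (proj₂ isMin)))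
               (trans (dominantFirst-value rs (proj₁ isMax) dom₁)
                      (cong not (maximal-avoids-S (east ∷ rs) isMin isMax)))
               (dominant-parity rs (proj₁ isMin) dom₁ dom₂)
               (dominant-parity rs (proj₁ isMax) dom₁ dom₂)
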